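{- Let $\mathbf{x},\mathbf{y}\in\mathbb{Z}_2^\alpha\times\mathbb{Z}_2[u]^\beta$. (i) If $\mathbf{x}\cdot\mathbf{y}=0$, then $\Psi(\mathbf{x})\cdot\Psi(\mathbf{y})=0$. (ii) If $\mathbf{x}\cdot\mathbf{y}\neq0$ and $\Psi(\mathbf{x})\cdot\Psi(\mathbf{y})=0$, then $\Psi(\mathbf{x})\cdot\Psi((1+u)\mathbf{y})=1$.
   Context: $\mathbb{Z}_2[u]=\{0,1,u,1+u\}$ is the ring with $u^2=0$; $\pi:\mathbb{Z}_2[u]\to\mathbb{Z}_2$ has $\pi(0)=\pi(u)=0$, $\pi(1)=\pi(1+u)=1$, and scalar multiplication on $\mathbb{Z}_2^\alpha\times\mathbb{Z}_2[u]^\beta$ is $\lambda(x_1,\dots,x_\alpha\mid x'_1,\dots,x'_\beta)=(\pi(\lambda)x_1,\dots,\pi(\lambda)x_\alpha\mid\lambda x'_1,\dots,\lambda x'_\beta)$. The map $\psi:\mathbb{Z}_2[u]\to\mathbb{Z}_2^2$ is $\psi(0)=(0,0)$, $\psi(1)=(0,1)$, $\psi(u)=(1,1)$, $\psi(1+u)=(1,0)$, extended coordinatewise, and $\Psi(x\mid x')=(x\mid\psi(x'))\in\mathbb{Z}_2^{\alpha+2\beta}$; the product $\Psi(\mathbf{x})\cdot\Psi(\mathbf{y})\in\mathbb{Z}_2$ is the standard binary inner product. The inner product on $\mathbb{Z}_2^\alpha\times\mathbb{Z}_2[u]^\beta$ is $(x\mid x')\cdot(y\mid y')=u\left(\sum_{i=1}^\alpha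 x_iy_i\right)+\sum_{j=1}^\beta x'_jy'_j\in\mathbb{Z}_2[u]$, with binary entries regarded as $0,1\in\mathbb{Z}_2[u]$. -}

module Defs where

open import Data.Bool using (Bool; true; false; _∧_; _xor_)
open import Data.Nat using (ℕ)
import Data.Nat
open import Data.Vec using (Vec; []; _∷_; map; zipWith; foldr; _++_; concat)
open import Data.Product using (_×_; _,_; proj₁; proj₂)

-- ℤ₂ is modelled by Bool: false = 0, true = 1, addition = xor, product = ∧.
Z2 : Set
Z2 = Bool

data Z2u : Set where
  𝟎 𝟏 𝐮 𝟏+𝐮 : Z2u

_⊕_ : Z2u → Z2u → Z2u
𝟎 ⊕ y = y
x ⊕ 𝟎 = x
𝟏 ⊕ 𝟏 = 𝟎
𝟏 ⊕ 𝐮 = 𝟏+𝐮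
𝟏 ⊕ 𝟏+𝐮 = 𝐮
𝐮 ⊕ 𝟏 = 𝟏+𝐮
𝐮 ⊕ 𝐮 = 𝟎
𝐮 ⊕ 𝟏+𝐮 = 𝟏
𝟏+𝐮 ⊕ 𝟏 = 𝐮
𝟏+𝐮 ⊕ 𝐮 = 𝟏
𝟏+𝐮 ⊕ 𝟏+𝐮 = 𝟎

_⊗_ : Z2u → Z2u → Z2u
𝟎 ⊗ y = 𝟎
𝟏 ⊗ y = y
𝐮 ⊗ 𝟎 = 𝟎
𝐮 ⊗ 𝟏 = 𝐮
𝐮 ⊗ 𝐮 = 𝟎
𝐮 ⊗ 𝟏+𝐮 = 𝐮
𝟏+𝐮 ⊗ 𝟎 = 𝟎
𝟏+𝐮 ⊗ 𝟏 = 𝟏+𝐮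
𝟏+𝐮 ⊗ 𝐮 = 𝐮
𝟏+𝐮 ⊗ 𝟏+𝐮 = 𝟏

π : Z2u → Z2
π 𝟎 = false
π 𝟏 = true
π 𝐮 = false
π 𝟏+𝐮 = true

ι : Z2 → Z2u
ι false = 𝟎
ι true = 𝟏

Code : ℕ → ℕ → Set
Code α β = Vec Z2 α × Vec Z2u β

_·ₛ_ : ∀ {α β} → Z2u → Code α β → Code α β
l ·ₛ (x , x') = map (π l ∧_) x , map (l ⊗_) x'

ψ : Z2u → Vec Z2 2
ψ 𝟎 = false ∷ false ∷ []
ψ 𝟏 = false ∷ true ∷ []
ψ 𝐮 = true ∷ true ∷ []
ψ 𝟏+𝐮 = true ∷ false ∷ []

Ψ : ∀ {α β} → Code α β → Vec Z2 (α Data.Nat.+ β Data.Nat.* 2)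
Ψ {α} {β} (x , x') = x ++ concat (map ψ x')

_·₂_ : ∀ {n} → Vec Z2 n → Vec Z2 n → Z2
a ·₂ b = foldr _ _xor_ false (zipWith _∧_ a b)

_·_ : ∀ {α β} → Code α β → Code α β → Z2u
(x , x') · (y , y') =
  (𝐮 ⊗ ι (x ·₂ y)) ⊕ foldr _ _⊕_ 𝟎 (zipWith _⊗_ x' y')

module Submission where

open import Defs
open import Data.Nat using (ℕ)
open import Data.Bool using (true; false; _∧_; _xor_)
open import Data.Bool.Properties using (xor-assoc; ∧-distribˡ-xor; ∧-comm; ∧-assoc)
open import Data.Product using (_×_; _,_)
open import Data.Vec using (Vec; []; _∷_; map; zipWith; foldr; _++_; concat)
open import Relation.Binary.PropositionalEquality
  using (_≡_; _≢_; refl; cong; cong₂; sym; trans; module ≡-Reasoning)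
open import Relation.Nullary using (contradiction)

-- Writing z = a + b u, the map θ z = a + b is additive and turns products into
-- Gray-image inner products: ψ p ·₂ ψ q = θ (p q).  Summing coordinatewise,
-- Ψ x ·₂ Ψ y = θ (x · y), which gives (i).  Moreover x · ((1+u) y) = (1+u)(x · y),
-- and the only nonzero z with θ z = 0 is z = 1 + u, for which θ ((1+u) z) = θ 1 = 1;
-- this gives (ii).

Z2u-ind : ∀ {P : Z2u → Set} → P 𝟎 → P 𝟏 → P 𝐮 → P 𝟏+𝐮 → ∀ z → P z
Z2u-ind p₀ p₁ pᵤ p₁₊ᵤ 𝟎 = p₀
Z2u-ind p₀ p₁ pᵤ p₁₊ᵤ 𝟏 = p₁
Z2u-ind p₀ p₁ pᵤ p₁₊ᵤ 𝐮 = pᵤ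
Z2u-ind p₀ p₁ pᵤ p₁₊ᵤ 𝟏+𝐮 = p₁₊ᵤ

⊗-distribˡ-⊕ : ∀ c p q → c ⊗ (p ⊕ q) ≡ (c ⊗ p) ⊕ (c ⊗ q)
⊗-distribˡ-⊕ = Z2u-ind (λ _ _ → refl) (λ _ _ → refl)
  (Z2u-ind (Z2u-ind refl refl refl refl) (Z2u-ind refl refl refl refl)
           (Z2u-ind refl refl refl refl) (Z2u-ind refl refl refl refl))
  (Z2u-ind (Z2u-ind refl refl refl refl) (Z2u-ind refl refl refl refl)
           (Z2u-ind refl refl refl refl) (Z2u-ind refl refl refl refl))

⊗-leftComm : ∀ p c q → p ⊗ (c ⊗ q) ≡ c ⊗ (p ⊗ q)
⊗-leftComm = Z2u-ind
  (Z2u-ind (λ _ → refl) (λ _ → refl) (λ _ → refl) (λ _ → refl))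
  (λ _ _ → refl)
  (Z2u-ind (λ _ → refl) (λ _ → refl)
           (Z2u-ind refl refl refl refl) (Z2u-ind refl refl refl refl))
  (Z2u-ind (λ _ → refl) (λ _ → refl)
           (Z2u-ind refl refl refl refl) (Z2u-ind refl refl refl refl))

θ : Z2u → Z2
θ 𝟎 = false
θ 𝟏 = true
θ 𝐮 = true
θ 𝟏+𝐮 = false

θ-⊕ : ∀ p q → θ (p ⊕ q) ≡ θ p xor θ q
θ-⊕ = Z2u-ind (Z2u-ind refl refl refl refl) (Z2u-ind refl refl refl refl)
              (Z2u-ind refl refl refl refl) (Z2u-ind refl refl refl refl)

ψ-·₂ : ∀ p q → ψ p ·₂ ψ q ≡ θ (p ⊗ q)
ψ-·₂ = Z2u-ind (Z2u-ind refl refl refl refl) (Z2u-ind refl refl refl refl)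
               (Z2u-ind refl refl refl refl) (Z2u-ind refl refl refl refl)

θ-𝐮⊗ι : ∀ a → θ (𝐮 ⊗ ι a) ≡ a
θ-𝐮⊗ι false = refl
θ-𝐮⊗ι true = refl

·₂-++ : ∀ {m n} (a b : Vec Z2 m) (c d : Vec Z2 n) →
        (a ++ c) ·₂ (b ++ d) ≡ (a ·₂ b) xor (c ·₂ d)
·₂-++ [] [] c d = refl
·₂-++ (a ∷ as) (b ∷ bs) c d =
  trans (cong ((a ∧ b) xor_) (·₂-++ as bs c d)) (sym (xor-assoc (a ∧ b) _ _))

concat-ψ-·₂ : ∀ {n} (x y : Vec Z2u n) →
  concat (map ψ x) ·₂ concat (map ψ y) ≡ θ (foldr _ _⊕_ 𝟎 (zipWith _⊗_ x y))
concat-ψ-·₂ [] [] = refl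
concat-ψ-·₂ (p ∷ x) (q ∷ y) = begin
  (ψ p ++ concat (map ψ x)) ·₂ (ψ q ++ concat (map ψ y))
    ≡⟨ ·₂-++ (ψ p) (ψ q) _ _ ⟩
  (ψ p ·₂ ψ q) xor (concat (map ψ x) ·₂ concat (map ψ y))
    ≡⟨ cong₂ _xor_ (ψ-·₂ p q) (concat-ψ-·₂ x y) ⟩
  θ (p ⊗ q) xor θ (foldr _ _⊕_ 𝟎 (zipWith _⊗_ x y))
    ≡⟨ sym (θ-⊕ (p ⊗ q) _) ⟩
  θ ((p ⊗ q) ⊕ foldr _ _⊕_ 𝟎 (zipWith _⊗_ x y)) ∎
  where open ≡-Reasoning

Ψ-·₂ : ∀ {α β} (x y : Code α β) → Ψ x ·₂ Ψ y ≡ θ (x · y)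
Ψ-·₂ (x , x′) (y , y′) = begin
  (x ++ concat (map ψ x′)) ·₂ (y ++ concat (map ψ y′))
    ≡⟨ ·₂-++ x y _ _ ⟩
  (x ·₂ y) xor (concat (map ψ x′) ·₂ concat (map ψ y′))
    ≡⟨ cong₂ _xor_ (sym (θ-𝐮⊗ι (x ·₂ y))) (concat-ψ-·₂ x′ y′) ⟩
  θ (𝐮 ⊗ ι (x ·₂ y)) xor θ (foldr _ _⊕_ 𝟎 (zipWith _⊗_ x′ y′))
    ≡⟨ sym (θ-⊕ (𝐮 ⊗ ι (x ·₂ y)) _) ⟩
  θ ((x , x′) · (y , y′)) ∎
  where open ≡-Reasoning

·₂-scaleʳ : ∀ {n} b (x y : Vec Z2 n) → x ·₂ map (b ∧_) y ≡ b ∧ (x ·₂ y)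
·₂-scaleʳ b [] [] = ∧-comm false b
·₂-scaleʳ b (a ∷ x) (c ∷ y) = begin
  (a ∧ (b ∧ c)) xor (x ·₂ map (b ∧_) y)
    ≡⟨ cong₂ _xor_ (a∧[b∧c]≡b∧[a∧c]) (·₂-scaleʳ b x y) ⟩
  (b ∧ (a ∧ c)) xor (b ∧ (x ·₂ y))
    ≡⟨ sym (∧-distribˡ-xor b (a ∧ c) _) ⟩
  b ∧ ((a ∧ c) xor (x ·₂ y)) ∎
  where
  open ≡-Reasoning
  a∧[b∧c]≡b∧[a∧c] : a ∧ (b ∧ c) ≡ b ∧ (a ∧ c)
  a∧[b∧c]≡b∧[a∧c] = trans (sym (∧-assoc a b c))
                     (trans (cong (_∧ c) (∧-comm a b)) (∧-assoc b a c))

⊗-sum-scaleʳ : ∀ {n} c (x y : Vec Z2u n) →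
  foldr _ _⊕_ 𝟎 (zipWith _⊗_ x (map (c ⊗_) y)) ≡ c ⊗ foldr _ _⊕_ 𝟎 (zipWith _⊗_ x y)
⊗-sum-scaleʳ c [] [] = Z2u-ind {λ c → 𝟎 ≡ c ⊗ 𝟎} refl refl refl refl c
⊗-sum-scaleʳ c (p ∷ x) (q ∷ y) =
  trans (cong₂ _⊕_ (⊗-leftComm p c q) (⊗-sum-scaleʳ c x y))
        (sym (⊗-distribˡ-⊕ c (p ⊗ q) _))

-- Since u² = 0, multiplying u by c only sees the constant term π c of c.
𝐮⊗ι-∧π : ∀ c a → 𝐮 ⊗ ι (π c ∧ a) ≡ c ⊗ (𝐮 ⊗ ι a)
𝐮⊗ι-∧π 𝟎 a = refl
𝐮⊗ι-∧π 𝟏 false = refl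
𝐮⊗ι-∧π 𝟏 true = refl
𝐮⊗ι-∧π 𝐮 false = refl
𝐮⊗ι-∧π 𝐮 true = refl
𝐮⊗ι-∧π 𝟏+𝐮 false = refl
𝐮⊗ι-∧π 𝟏+𝐮 true = refl

·-·ₛ : ∀ {α β} c (x y : Code α β) → x · (c ·ₛ y) ≡ c ⊗ (x · y)
·-·ₛ c (x , x′) y@(b , b′) = begin
  (𝐮 ⊗ ι (x ·₂ map (π c ∧_) b)) ⊕ foldr _ _⊕_ 𝟎 (zipWith _⊗_ x′ (map (c ⊗_) b′))
    ≡⟨ cong₂ (λ s t → (𝐮 ⊗ ι s) ⊕ t) (·₂-scaleʳ (π c) x b) (⊗-sum-scaleʳ c x′ b′) ⟩
  (𝐮 ⊗ ι (π c ∧ (x ·₂ b))) ⊕ (c ⊗ foldr _ _⊕_ 𝟎 (zipWith _⊗_ x′ b′))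
    ≡⟨ cong (_⊕ _) (𝐮⊗ι-∧π c (x ·₂ b)) ⟩
  (c ⊗ (𝐮 ⊗ ι (x ·₂ b))) ⊕ (c ⊗ foldr _ _⊕_ 𝟎 (zipWith _⊗_ x′ b′))
    ≡⟨ sym (⊗-distribˡ-⊕ c _ _) ⟩
  c ⊗ ((x , x′) · y) ∎
  where open ≡-Reasoning

θ-𝟏+𝐮⊗ : ∀ z → z ≢ 𝟎 → θ z ≡ false → θ (𝟏+𝐮 ⊗ z) ≡ true
θ-𝟏+𝐮⊗ 𝟎 z≢𝟎 _ = contradiction refl z≢𝟎
θ-𝟏+𝐮⊗ 𝟏 _ ()
θ-𝟏+𝐮⊗ 𝐮 _ ()
θ-𝟏+𝐮⊗ 𝟏+𝐮 _ _ = refl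

proposition1 : ∀ {α β : ℕ} (x y : Code α β) →
    (x · y ≡ 𝟎 → Ψ x ·₂ Ψ y ≡ false) ×
    (x · y ≢ 𝟎 → Ψ x ·₂ Ψ y ≡ false → Ψ x ·₂ Ψ (𝟏+𝐮 ·ₛ y) ≡ true)
proposition1 x y = part-i , part-ii
  where
  part-i : x · y ≡ 𝟎 → Ψ x ·₂ Ψ y ≡ false
  part-i x·y≡𝟎 = trans (Ψ-·₂ x y) (cong θ x·y≡𝟎)

  part-ii : x · y ≢ 𝟎 → Ψ x ·₂ Ψ y ≡ false → Ψ x ·₂ Ψ (𝟏+𝐮 ·ₛ y) ≡ true
  part-ii x·y≢𝟎 Ψx·Ψy≡0 = begin
    Ψ x ·₂ Ψ (𝟏+𝐮 ·ₛ y)  ≡⟨ Ψ-·₂ x (𝟏+𝐮 ·ₛ y) ⟩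
    θ (x · (𝟏+𝐮 ·ₛ y))   ≡⟨ cong θ (·-·ₛ 𝟏+𝐮 x y) ⟩
    θ (𝟏+𝐮 ⊗ (x · y))    ≡⟨ θ-𝟏+𝐮⊗ (x · y) x·y≢𝟎 (trans (sym (Ψ-·₂ x y)) Ψx·Ψy≡0) ⟩
    true                 ∎
    where open ≡-Reasoning
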